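{- Let $\mathcal{A}$ be the set of $(m+n)$-tuples $\mathbf{t}=(t_1,\dots,t_{m+n})$ with $t_i>0$ for all $i$ and $\sum_{i=1}^m t_i=\sum_{j=1}^n t_{m+j}$. Then $\mathcal{E}^+=\bigcap_{\mathbf{t}\in\mathcal{A}}\mathcal{E}^+_{\mathbf{t}}$.
   Context: $W=\mathbb{R}^{m+n}$ with standard basis $\mathbf{e}_1,\dots,\mathbf{e}_{m+n}$; $\bigwedge(W)$ is its exterior algebra. For $I=\{i_1<\dots<i_\ell\}\subset\{1,\dots,m+n\}$, $\mathbf{e}_I=\mathbf{e}_{i_1}\wedge\dots\wedge\mathbf{e}_{i_\ell}$ ($\mathbf{e}_\varnothing=1$). For $\mathbf{t}\in\mathcal{A}$ let $g_{\mathbf{t}}=\operatorname{diag}(e^{t_1},\dots,e^{t_m},e^{ -t_{m+1}},\dots,e^{ -t_{m+n}})$ acting on $\bigwedge(W)$; $\mathcal{E}^+_{\mathbf{t}}$ is the span of the eigenvectors of $g_{\mathbf{t}}$ in $\bigwedge(W)$ with eigenvalue $\ge1$, i.e. the span of all $\mathbf{e}_I\wedge\mathbf{e}_J$ with $I\subset\{1,\dots,m\}$, $J\subset\{m+1,\dots,m+n\}$ and $\sum_{i\in I}t_i\ge\sum_{j\in J}t_j$. $\mathcal{E}^+$ is the span of all $\mathbf{e}_I$ and all $\mathbf{e}_{\{1,\dots,m\}}\wedge\mathbf{e}_J$ with $I\subset\{1,\dots,m\}$, $J\subset\{m+1,\dots,m+n\}$.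
   Formalization: The tuples t in $\mathcal{A}$ and the coefficients of elements of $\bigwedge(W)$ are taken in ℚ rather than ℝ. -}

module Defs where

open import Data.Nat using (ℕ; zero; suc)
open import Data.Fin using (Fin) renaming (zero to fz; suc to fs)
open import Data.Bool using (true; false)
open import Data.Vec using (_∷_; [])
open import Data.Fin.Subset using (Subset; ⊥; ⊤)
open import Data.Rational using (ℚ; 0ℚ; _+_; _<_; _≤_)
open import Data.Product using (_×_)
open import Data.Sum using (_⊎_)
open import Relation.Binary.PropositionalEquality using (_≡_)
open import Relation.Nullary using (¬_)

sumOver : {k : ℕ} → Subset k → (Fin k → ℚ) → ℚ
sumOver [] f = 0ℚ
sumOver (true ∷ I) f = f fz + sumOver I (λ i → f (fs i))
sumOver (false ∷ I) f = sumOver I (λ i → f (fs i))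

-- A tuple t = (t_1..t_{m+n}) is given as its two halves
--   s i = t_i (i = 1..m),   u j = t_{m+j} (j = 1..n).
-- The set 𝒜:
InA : (m n : ℕ) → (Fin m → ℚ) → (Fin n → ℚ) → Set
InA m n s u = (∀ i → 0ℚ < s i) × (∀ j → 0ℚ < u j) × (sumOver ⊤ s ≡ sumOver ⊤ u)

-- The exterior algebra ⋀(W) (coefficients in ℚ): its basis is
-- e_I ∧ e_J, with I ⊆ {1..m}, J ⊆ {m+1..m+n} (J re-indexed as a subset of Fin n),
-- so an element is its coefficient function.
Ext : ℕ → ℕ → Set
Ext m n = Subset m → Subset n → ℚ

InSpan : {m n : ℕ} → (Subset m → Subset n → Set) → Ext m n → Set
InSpan P v = ∀ I J → ¬ (v I J ≡ 0ℚ) → P I J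

Eplus-t : {m n : ℕ} → (Fin m → ℚ) → (Fin n → ℚ) → Ext m n → Set
Eplus-t s u = InSpan (λ I J → sumOver J u ≤ sumOver I s)

Eplus : {m n : ℕ} → Ext m n → Set
Eplus = InSpan (λ I J → (J ≡ ⊥) ⊎ (I ≡ ⊤))

-- Both spaces are spanned by basis vectors, so it suffices to decide for each index (I, J)
-- whether Σ_{j∈J} t_{m+j} ≤ Σ_{i∈I} t_i for all t ∈ 𝒜. This holds when J = ∅ by positivity,
-- and when I = {1..m} because then Σ_J ≤ Σ_{all j} = Σ_I on 𝒜. Otherwise pick i₀ ∉ I and
-- j₀ ∈ J, and take all weights 1 except t_{i₀} = n + 2 and t_{m+j₀} = m + 2: both totals are
-- m + n + 2, yet Σ_I ≤ m < m + 2 ≤ Σ_J.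
module Submission where

open import Defs
open import Data.Nat using (ℕ; zero; suc)
open import Data.Fin using (Fin) renaming (zero to fz; suc to fs)
open import Data.Fin.Subset using (Subset; ⊥; ⊤; _∈_; _∉_; ∁; Nonempty; inside; outside)
open import Data.Fin.Subset.Properties using (Empty-unique; nonempty?; ∈⊤; ⊆-antisym; x∉∁p⇒x∈p; x∈∁p⇒x∉p)
open import Data.Vec using (_∷_; []; here; there)
open import Data.Rational using (ℚ; 0ℚ; 1ℚ; _+_; _<_; _≤_)
open import Data.Rational.Properties
open import Algebra.Bundles using (CommutativeMonoid)
open import Algebra.Properties.CommutativeSemigroup
  (CommutativeMonoid.commutativeSemigroup +-0-commutativeMonoid) using (interchange)
open import Data.Product using (_×_; _,_; ∃)
open import Data.Sum using (_⊎_; inj₁; inj₂)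
open import Data.Empty using (⊥-elim)
open import Function using (_∘_)
open import Relation.Binary.PropositionalEquality using (_≡_; refl; sym; trans; cong; subst)
open import Relation.Nullary using (yes; no; contradiction)

module _ {k : ℕ} where

  emptyOrNonempty : (p : Subset k) → p ≡ ⊥ ⊎ Nonempty p
  emptyOrNonempty p with nonempty? p
  ... | yes ne = inj₂ ne
  ... | no ¬ne = inj₁ (Empty-unique ¬ne)

  fullOrMissing : (p : Subset k) → p ≡ ⊤ ⊎ ∃ (_∉ p)
  fullOrMissing p with nonempty? (∁ p)
  ... | yes (x , x∈∁p) = inj₂ (x , x∈∁p⇒x∉p x∈∁p)
  ... | no ∁p-empty = inj₁ (⊆-antisym (λ _ → ∈⊤) (λ {x} _ → x∉∁p⇒x∈p (∁p-empty ∘ (x ,_))))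

sumOver-zero : ∀ {k} (I : Subset k) → sumOver I (λ _ → 0ℚ) ≡ 0ℚ
sumOver-zero []            = refl
sumOver-zero (inside ∷ I)  = cong (0ℚ +_) (sumOver-zero I)
sumOver-zero (outside ∷ I) = sumOver-zero I

sumOver-⊥ : ∀ {k} (f : Fin k → ℚ) → sumOver ⊥ f ≡ 0ℚ
sumOver-⊥ {zero} f = refl
sumOver-⊥ {suc k} f = sumOver-⊥ (f ∘ fs)

sumOver-+ : ∀ {k} (I : Subset k) (f g : Fin k → ℚ) →
  sumOver I (λ i → f i + g i) ≡ sumOver I f + sumOver I g
sumOver-+ []            f g = sym (+-identityʳ 0ℚ)
sumOver-+ (inside ∷ I)  f g =
  trans (cong ((f fz + g fz) +_) (sumOver-+ I (f ∘ fs) (g ∘ fs)))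
        (interchange (f fz) (g fz) (sumOver I (f ∘ fs)) (sumOver I (g ∘ fs)))
sumOver-+ (outside ∷ I) f g = sumOver-+ I (f ∘ fs) (g ∘ fs)

sumOver-nonneg : ∀ {k} (I : Subset k) (f : Fin k → ℚ) → (∀ i → 0ℚ ≤ f i) → 0ℚ ≤ sumOver I f
sumOver-nonneg []            f f≥0 = ≤-refl
sumOver-nonneg (inside ∷ I)  f f≥0 = subst (_≤ sumOver (inside ∷ I) f) (+-identityʳ 0ℚ)
  (+-mono-≤ (f≥0 fz) (sumOver-nonneg I (f ∘ fs) (f≥0 ∘ fs)))
sumOver-nonneg (outside ∷ I) f f≥0 = sumOver-nonneg I (f ∘ fs) (f≥0 ∘ fs)

sumOver-≤-⊤ : ∀ {k} (I : Subset k) (f : Fin k → ℚ) → (∀ i → 0ℚ ≤ f i) → sumOver I f ≤ sumOver ⊤ f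
sumOver-≤-⊤ []            f f≥0 = ≤-refl
sumOver-≤-⊤ (inside ∷ I)  f f≥0 = +-monoʳ-≤ (f fz) (sumOver-≤-⊤ I (f ∘ fs) (f≥0 ∘ fs))
sumOver-≤-⊤ (outside ∷ I) f f≥0 = subst (_≤ sumOver ⊤ f) (+-identityˡ (sumOver I (f ∘ fs)))
  (+-mono-≤ (f≥0 fz) (sumOver-≤-⊤ I (f ∘ fs) (f≥0 ∘ fs)))

pointMass : ∀ {k} → Fin k → ℚ → Fin k → ℚ
pointMass fz     c fz     = c
pointMass fz     c (fs _) = 0ℚ
pointMass (fs _) c fz     = 0ℚ
pointMass (fs j) c (fs i) = pointMass j c i

pointMass-nonneg : ∀ {k} (j : Fin k) {c : ℚ} → 0ℚ ≤ c → ∀ i → 0ℚ ≤ pointMass j c i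
pointMass-nonneg fz     c≥0 fz     = c≥0
pointMass-nonneg fz     c≥0 (fs _) = ≤-refl
pointMass-nonneg (fs _) c≥0 fz     = ≤-refl
pointMass-nonneg (fs j) c≥0 (fs i) = pointMass-nonneg j c≥0 i

sumOver-pointMass-∈ : ∀ {k} {I : Subset k} {j : Fin k} (c : ℚ) → j ∈ I → sumOver I (pointMass j c) ≡ c
sumOver-pointMass-∈ {I = inside ∷ I}  c here = trans (cong (c +_) (sumOver-zero I)) (+-identityʳ c)
sumOver-pointMass-∈ {I = inside ∷ I}  c (there j∈I) = trans (+-identityˡ _) (sumOver-pointMass-∈ c j∈I)
sumOver-pointMass-∈ {I = outside ∷ I} c (there j∈I) = sumOver-pointMass-∈ c j∈I

sumOver-pointMass-∉ : ∀ {k} {I : Subset k} {j : Fin k} (c : ℚ) → j ∉ I → sumOver I (pointMass j c) ≡ 0ℚ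
sumOver-pointMass-∉ {I = inside ∷ I}  {fz}   c j∉I = contradiction here j∉I
sumOver-pointMass-∉ {I = outside ∷ I} {fz}   c j∉I = sumOver-zero I
sumOver-pointMass-∉ {I = inside ∷ I}  {fs j} c j∉I = trans (+-identityˡ _) (sumOver-pointMass-∉ c (j∉I ∘ there))
sumOver-pointMass-∉ {I = outside ∷ I} {fs j} c j∉I = sumOver-pointMass-∉ c (j∉I ∘ there)

0<1 : 0ℚ < 1ℚ
0<1 = positive⁻¹ 1ℚ

0≤1 : 0ℚ ≤ 1ℚ
0≤1 = <⇒≤ 0<1

0≤x⇒0<x+1 : ∀ x → 0ℚ ≤ x → 0ℚ < x + 1ℚ
0≤x⇒0<x+1 x x≥0 = subst (_< x + 1ℚ) (+-identityʳ 0ℚ) (+-mono-≤-< x≥0 0<1)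

0≤x⇒y<y+1+x : ∀ x y → 0ℚ ≤ x → y < (y + 1ℚ) + x
0≤x⇒y<y+1+x x y x≥0 = begin-strict
  y              ≡⟨ sym (+-identityʳ y) ⟩
  y + 0ℚ         <⟨ +-monoʳ-< y 0<1 ⟩
  y + 1ℚ         ≡⟨ sym (+-identityʳ (y + 1ℚ)) ⟩
  (y + 1ℚ) + 0ℚ  ≤⟨ +-monoʳ-≤ (y + 1ℚ) x≥0 ⟩
  (y + 1ℚ) + x   ∎
  where open ≤-Reasoning

pointMass+1-pos : ∀ {k} (j : Fin k) (c : ℚ) → 0ℚ ≤ c → ∀ i → 0ℚ < pointMass j c i + 1ℚ
pointMass+1-pos j c c≥0 i = 0≤x⇒0<x+1 (pointMass j c i) (pointMass-nonneg j c≥0 i)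

module SeparatingWeights {m n : ℕ} (i₀ : Fin m) (j₀ : Fin n) where

  one : ∀ {k} → Fin k → ℚ
  one _ = 1ℚ

  M N : ℚ
  M = sumOver ⊤ (one {m})
  N = sumOver ⊤ (one {n})

  s : Fin m → ℚ
  s i = pointMass i₀ (N + 1ℚ) i + 1ℚ

  u : Fin n → ℚ
  u j = pointMass j₀ (M + 1ℚ) j + 1ℚ

  sum-s-∉ : ∀ I → i₀ ∉ I → sumOver I s ≡ sumOver I one
  sum-s-∉ I i₀∉I = trans (sumOver-+ I (pointMass i₀ (N + 1ℚ)) one)
    (trans (cong (_+ sumOver I one) (sumOver-pointMass-∉ (N + 1ℚ) i₀∉I)) (+-identityˡ (sumOver I one)))

  sum-s-∈ : ∀ I → i₀ ∈ I → sumOver I s ≡ (N + 1ℚ) + sumOver I one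
  sum-s-∈ I i₀∈I = trans (sumOver-+ I (pointMass i₀ (N + 1ℚ)) one)
    (cong (_+ sumOver I one) (sumOver-pointMass-∈ (N + 1ℚ) i₀∈I))

  sum-u-∈ : ∀ J → j₀ ∈ J → sumOver J u ≡ (M + 1ℚ) + sumOver J one
  sum-u-∈ J j₀∈J = trans (sumOver-+ J (pointMass j₀ (M + 1ℚ)) one)
    (cong (_+ sumOver J one) (sumOver-pointMass-∈ (M + 1ℚ) j₀∈J))

  balanced : sumOver ⊤ s ≡ sumOver ⊤ u
  balanced = begin
    sumOver ⊤ s     ≡⟨ sum-s-∈ ⊤ ∈⊤ ⟩
    (N + 1ℚ) + M    ≡⟨ +-assoc N 1ℚ M ⟩
    N + (1ℚ + M)    ≡⟨ cong (N +_) (+-comm 1ℚ M) ⟩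
    N + (M + 1ℚ)    ≡⟨ +-comm N (M + 1ℚ) ⟩
    (M + 1ℚ) + N    ≡⟨ sym (sum-u-∈ ⊤ ∈⊤) ⟩
    sumOver ⊤ u     ∎
    where open Relation.Binary.PropositionalEquality.≡-Reasoning

  one≥0 : ∀ {k} (i : Fin k) → 0ℚ ≤ one i
  one≥0 _ = 0≤1

  inA : InA m n s u
  inA = pointMass+1-pos i₀ (N + 1ℚ) (<⇒≤ (0≤x⇒0<x+1 N (sumOver-nonneg ⊤ (one {n}) one≥0)))
      , pointMass+1-pos j₀ (M + 1ℚ) (<⇒≤ (0≤x⇒0<x+1 M (sumOver-nonneg ⊤ (one {m}) one≥0)))
      , balanced

  separates : ∀ I J → i₀ ∉ I → j₀ ∈ J → sumOver I s < sumOver J u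
  separates I J i₀∉I j₀∈J = begin-strict
    sumOver I s               ≡⟨ sum-s-∉ I i₀∉I ⟩
    sumOver I one             ≤⟨ sumOver-≤-⊤ I one one≥0 ⟩
    M                         <⟨ 0≤x⇒y<y+1+x (sumOver J one) M (sumOver-nonneg J one one≥0) ⟩
    (M + 1ℚ) + sumOver J one  ≡⟨ sym (sum-u-∈ J j₀∈J) ⟩
    sumOver J u               ∎
    where open ≤-Reasoning

module _ {m n : ℕ} {I : Subset m} {J : Subset n} where

  Eplus-index⇒Eplus-t-index : {s : Fin m → ℚ} {u : Fin n → ℚ} →
    InA m n s u → J ≡ ⊥ ⊎ I ≡ ⊤ → sumOver J u ≤ sumOver I s
  Eplus-index⇒Eplus-t-index {s} {u} (s>0 , u>0 , _) (inj₁ refl) =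
    subst (_≤ sumOver I s) (sym (sumOver-⊥ u)) (sumOver-nonneg I s (<⇒≤ ∘ s>0))
  Eplus-index⇒Eplus-t-index {s} {u} (_ , u>0 , Σs≡Σu) (inj₂ refl) =
    subst (sumOver J u ≤_) (sym Σs≡Σu) (sumOver-≤-⊤ J u (<⇒≤ ∘ u>0))

  Eplus-t-index-on-A⇒Eplus-index :
    (∀ s u → InA m n s u → sumOver J u ≤ sumOver I s) → J ≡ ⊥ ⊎ I ≡ ⊤
  Eplus-t-index-on-A⇒Eplus-index on-A with emptyOrNonempty J | fullOrMissing I
  ... | inj₁ J≡⊥ | _ = inj₁ J≡⊥
  ... | inj₂ _ | inj₁ I≡⊤ = inj₂ I≡⊤
  ... | inj₂ (j₀ , j₀∈J) | inj₂ (i₀ , i₀∉I) =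
    ⊥-elim (<-irrefl refl (<-≤-trans (separates I J i₀∉I j₀∈J) (on-A s u inA)))
    where open SeparatingWeights i₀ j₀

lemma4p4 : (m n : ℕ) (v : Ext m n) →
    (Eplus v → ((s : Fin m → ℚ) (u : Fin n → ℚ) → InA m n s u → Eplus-t s u v))
    × (((s : Fin m → ℚ) (u : Fin n → ℚ) → InA m n s u → Eplus-t s u v) → Eplus v)
lemma4p4 m n v =
    (λ v∈E⁺ s u t∈A I J vIJ≢0 → Eplus-index⇒Eplus-t-index t∈A (v∈E⁺ I J vIJ≢0))
  , (λ v∈E⁺ₜ I J vIJ≢0 → Eplus-t-index-on-A⇒Eplus-index (λ s u t∈A → v∈E⁺ₜ s u t∈A I J vIJ≢0))
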